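{- Every normal form $\mathrm{FO}^2_{\mathrm{MOD}}[\leq,\mathit{succ}]$ formula $\varphi$ satisfiable over finite words has a model $\mathfrak{W}$ (a finite word) of size at most $\mathfrak{f}(\varphi)$.
   Context: $\mathrm{FO}^2_{\mathrm{MOD}}[\leq,\mathit{succ}]$: two-variable first-order logic over a signature of unary symbols $\tau_0$ plus $\leq,\mathit{succ}$, extended with modulo quantifiers $\exists^{\bowtie k,l}$ ($\bowtie\in\{\leq,=,\geq\}$, $l\ge1$, $0\le k<l$) with $\mathfrak{M},a\models\exists^{\bowtie k,l}y\,\phi(x,y)$ iff $(|\{b:\mathfrak{M}\models\phi[a,b]\}|\bmod l)\bowtie k$. It is interpreted over finite words: finite sets of positions with $\leq$ the linear order and $\mathit{succ}$ the successor relation, each position labeled by an arbitrary subset of $\tau_0$. Normal form: $\varphi=\forall x\forall y\,\chi(x,y)\wedge\bigwedge_{i=1}^n\forall x\exists y\,\chi_i(x,y)\wedge\bigwedge_{j=1}^m\forall x\,\exists^{\bowtie_j k_j,l_j}y\,\psi_j(x,y)$ with $n,m\ge1$, $\bowtie_j\in\{\le,\ge\}$, $\chi,\chi_i,\psi_j$ quantifier-free. An atomic 1-type is a maximal satisfiable set of atoms and negated atoms in the variable $x$ over the signature of $\varphi$; let $|\boldsymbol{\alpha}|$ be the number of such 1-types. Define $\mathfrak{f}(\varphi)=(2\,l_1 l_2\cdots l_m)^{5\,|\boldsymbol{\alpha}|}$ (here $5$ is the number of order formulas for words: $x=y$, $\mathit{succ}(x,y)$, $\mathit{succ}(y,x)$,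 $x\neq y\wedge\neg\mathit{succ}(x,y)\wedge x\le y$, $x\ne y\wedge\neg\mathit{succ}(y,x)\wedge y\le x$). -}

module Defs where

open import Data.Nat using (ℕ; zero; suc; _+_; _*_; _^_; _≤_; _<_; _≤ᵇ_; _≡ᵇ_; _%_; >-nonZero)
open import Data.Bool using (Bool; true; false; not; _∧_; _∨_; T)
open import Data.Fin using (Fin; toℕ)
open import Data.Fin.Subset using (Subset; ⊥; ⁅_⁆; _∪_; ∣_∣)
open import Data.Vec using (lookup; tabulate)
open import Data.List using (List; length; foldr; map)
open import Data.Nat.ListAction using (product)
open import Data.List.Relation.Unary.All using (All)
open import Data.Product using (Σ; ∃; _×_)

data Var : Set where
  vx vy : Var

data QF (s : ℕ) : Set where
  atom  : Fin s → Var → QF s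
  leq   : Var → Var → QF s
  succ  : Var → Var → QF s            -- succ(v, w)  (w is the successor of v)
  eq    : Var → Var → QF s
  tt    : QF s
  ¬ᶠ_   : QF s → QF s
  _∧ᶠ_  : QF s → QF s → QF s
  _∨ᶠ_  : QF s → QF s → QF s

-- A finite word of length N over the alphabet of subsets of τ0:
-- positions are Fin N, ordered by their natural order.
Word : ℕ → ℕ → Set
Word s N = Fin N → Subset s

pos : ∀ {N} → Fin N → Fin N → Var → Fin N
pos a b vx = a
pos a b vy = b

eval : ∀ {s N} → QF s → Word s N → Fin N → Fin N → Bool
eval (atom P v) w a b = lookup (w (pos a b v)) P
eval (leq u v)  w a b = toℕ (pos a b u) ≤ᵇ toℕ (pos a b v)
eval (succ u v) w a b = suc (toℕ (pos a b u)) ≡ᵇ toℕ (pos a b v)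
eval (eq u v)   w a b = toℕ (pos a b u) ≡ᵇ toℕ (pos a b v)
eval tt         w a b = true
eval (¬ᶠ φ)     w a b = not (eval φ w a b)
eval (φ ∧ᶠ ψ)   w a b = eval φ w a b ∧ eval ψ w a b
eval (φ ∨ᶠ ψ)   w a b = eval φ w a b ∨ eval ψ w a b

data Cmp : Set where
  le ge : Cmp

-- A conjunct  ∀x ∃^{⋈ k, l} y ψ(x,y)  with l ≥ 1 and 0 ≤ k < l.
record ModConj (s : ℕ) : Set where
  field
    cmp : Cmp
    k   : ℕ
    l   : ℕ
    l≥1 : 1 ≤ l
    k<l : k < l
    ψ   : QF s

-- Normal form formula
--   ∀x∀y χ ∧ ⋀_{i=1}^n ∀x∃y χ_i ∧ ⋀_{j=1}^m ∀x ∃^{⋈_j k_j,l_j} y ψ_j,  n,m ≥ 1.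
record NF (s : ℕ) : Set where
  field
    χ      : QF s
    exs    : List (QF s)
    n≥1    : 1 ≤ length exs
    mods   : List (ModConj s)
    m≥1    : 1 ≤ length mods

count : ∀ {s N} → QF s → Word s N → Fin N → ℕ
count ψ w a = ∣ tabulate (λ b → eval ψ w a b) ∣

modHolds : ∀ {s N} → ModConj s → Word s N → Fin N → Set
modHolds {s} {N} mc w a with ModConj.cmp mc
... | le = (_%_ (count (ModConj.ψ mc) w a) (ModConj.l mc) {{>-nonZero (ModConj.l≥1 mc)}}) ≤ ModConj.k mc
... | ge = ModConj.k mc ≤ (_%_ (count (ModConj.ψ mc) w a) (ModConj.l mc) {{>-nonZero (ModConj.l≥1 mc)}})

_⊨_ : ∀ {s N} → Word s N → NF s → Set
_⊨_ {s} {N} w φ =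
  ((a b : Fin N) → T (eval (NF.χ φ) w a b))
  × All (λ χi → (a : Fin N) → ∃ λ b → T (eval χi w a b)) (NF.exs φ)
  × All (λ mc → (a : Fin N) → modHolds mc w a) (NF.mods φ)

symQF : ∀ {s} → QF s → Subset s
symQF (atom P v) = ⁅ P ⁆
symQF (leq u v)  = ⊥
symQF (succ u v) = ⊥
symQF (eq u v)   = ⊥
symQF tt         = ⊥
symQF (¬ᶠ φ)     = symQF φ
symQF (φ ∧ᶠ ψ)   = symQF φ ∪ symQF ψ
symQF (φ ∨ᶠ ψ)   = symQF φ ∪ symQF ψ

sig : ∀ {s} → NF s → Subset s
sig φ = symQF (NF.χ φ)
      ∪ (foldr _∪_ ⊥ (map symQF (NF.exs φ))
      ∪ foldr _∪_ ⊥ (map (λ mc → symQF (ModConj.ψ mc)) (NF.mods φ)))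

-- Over words the
-- atoms x=x, x≤x are always true and succ(x,x) always false, so a
-- maximal satisfiable set of literals in x is determined by an arbitrary
-- choice of the unary symbols of φ that hold: 2^{|sig φ|} types.
oneTypes : ∀ {s} → NF s → ℕ
oneTypes φ = 2 ^ ∣ sig φ ∣

bound : ∀ {s} → NF s → ℕ
bound φ = (2 * product (map ModConj.l (NF.mods φ))) ^ (5 * oneTypes φ)

module Submission where

-- A word is read as a sequence of atomic 1-types over the
-- signature of φ (Types, Bridge); the truth value of a quantifier-free
-- formula at (x , y) depends only on the two 1-types and on which of five
-- order types (x , y) has (ord, eval-local).  Removing a block [c , c + d)
-- from a word (skip) keeps every order type seen from a position far from
-- the cut, and lowers its witness counts by the block's contribution
-- (SingleCut).  The profile of a position p records, for every 1-type t,
-- whether t sits at p or p + 1, occurs before p or after p + 1, and the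
-- residues of the far-right (resp. far-left) witness counts of t among the
-- positions below p + 2 (resp. p).  If p and p + d have equal profiles,
-- removing [p + 2 , p + 2 + d), which gives the same word as removing
-- [p , p + d), preserves models: every position is far from one of the two
-- cuts (Pump).  There are (16 l₁² ⋯ lₘ²)^|α| < 𝔣(φ) profiles, so by the
-- pigeonhole principle a model longer than 𝔣(φ) has a shorter one
-- (Shrinking); lemma7 follows by well-founded induction on the length.

open import Defs
open import Data.Bool using (Bool; true; false; not; _∧_; _∨_; T)
open import Data.Fin using (Fin; toℕ; fromℕ<; combine; funToFin; finToFun) renaming (_≟_ to _≟ᶠ_)
open import Data.Fin.Properties
  using (2↔Bool; finToFun-funToFin; toℕ-fromℕ<; fromℕ<-toℕ; toℕ<n; combine-injective; pigeonhole)
open import Data.Fin.Subset using (Subset; ⊥; _∪_; _⊆_; ∣_∣) renaming (_∈_ to _∈ˢ_)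
open import Data.Fin.Subset.Properties using (p⊆p∪q; q⊆p∪q; ⊆-trans; x∈⁅x⁆)
open import Data.List using (List; []; _∷_; foldr; map)
open import Data.List.Membership.Propositional using (_∈_)
open import Data.List.Relation.Unary.Any using (here; there)
import Data.List.Relation.Unary.All as All
open import Data.Nat
  using (ℕ; zero; suc; _+_; _*_; _^_; _∸_; _/_; _%_; _≤_; _<_; _≤ᵇ_; _≡ᵇ_; z≤n; s≤s;
         _≟_; _<?_; _≤?_; NonZero; >-nonZero)
open import Data.Nat.Properties
open import Data.Nat.Divisibility using (_∣_; n∣m*n; ∣m+n∣m⇒∣n)
open import Data.Nat.DivMod using (m≡m%n+[m/n]*n; m%n<n; %-remove-+ʳ)
open import Data.Nat.Induction using (<-rec)
open import Data.Nat.ListAction using (product)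
open import Data.Nat.Tactic.RingSolver using (solve-∀)
open import Data.Product using (Σ; ∃; ∃₂; _×_; _,_; proj₁; proj₂)
open import Data.Sum using (_⊎_; inj₁; inj₂) renaming (map to map⊎)
open import Data.Vec using (Vec; []; _∷_; lookup; tabulate)
import Data.Vec as Vec
open import Data.Vec.Properties using (tabulate-cong; tabulate∘lookup)
open import Function using (_∘_; Inverse)
open import Relation.Nullary using (Dec; yes; no; _×-dec_; contradiction)
open import Relation.Binary.PropositionalEquality

-- The five order types of a pair of positions (a , b): a = b, b = a + 1,
-- a = b + 1, b ≥ a + 2 (b far to the right) and a ≥ b + 2 (b far to the left).
data OrdType : Set where
  self adjR adjL farR farL : OrdType

ord : ℕ → ℕ → OrdType
ord (suc a)       (suc b)       = ord a b
ord zero          zero          = self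
ord zero          (suc zero)    = adjR
ord zero          (suc (suc _)) = farR
ord (suc zero)    zero          = adjL
ord (suc (suc _)) zero          = farL

mirror : OrdType → OrdType
mirror self = self
mirror adjR = adjL
mirror adjL = adjR
mirror farR = farL
mirror farL = farR

ord-mirror : ∀ a b → ord b a ≡ mirror (ord a b)
ord-mirror (suc a)       (suc b)       = ord-mirror a b
ord-mirror zero          zero          = refl
ord-mirror zero          (suc zero)    = refl
ord-mirror zero          (suc (suc _)) = refl
ord-mirror (suc zero)    zero          = refl
ord-mirror (suc (suc _)) zero          = refl

ord-refl : ∀ a → ord a a ≡ self
ord-refl zero    = refl
ord-refl (suc a) = ord-refl a

ord-farR : ∀ {a b} → suc (suc a) ≤ b → ord a b ≡ farR
ord-farR {zero}  {suc (suc _)} _         = refl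
ord-farR {zero}  {suc zero}    (s≤s ())
ord-farR {suc a} {suc b}       (s≤s a<b) = ord-farR a<b

ord-farL : ∀ {a b} → suc (suc b) ≤ a → ord a b ≡ farL
ord-farL {suc (suc _)} {zero}  _         = refl
ord-farL {suc zero}    {zero}  (s≤s ())
ord-farL {suc a}       {suc b} (s≤s b<a) = ord-farL b<a

ord-shift : ∀ k a b → ord (k + a) (k + b) ≡ ord a b
ord-shift zero    a b = refl
ord-shift (suc k) a b = ord-shift k a b

ord-shiftʳ : ∀ k a b → ord (a + k) (b + k) ≡ ord a b
ord-shiftʳ k a b rewrite +-comm a k | +-comm b k = ord-shift k a b

isLeq isAdjR isSame : OrdType → Bool
isLeq self = true
isLeq adjR = true
isLeq farR = true
isLeq _    = false
isAdjR adjR = true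
isAdjR _    = false
isSame self = true
isSame _    = false

≤ᵇ-ord : ∀ m n → (m ≤ᵇ n) ≡ isLeq (ord m n)
≤ᵇ-ord (suc zero)    (suc n)       = ≤ᵇ-ord zero n
≤ᵇ-ord (suc (suc m)) (suc n)       = ≤ᵇ-ord (suc m) n
≤ᵇ-ord zero          zero          = refl
≤ᵇ-ord zero          (suc zero)    = refl
≤ᵇ-ord zero          (suc (suc _)) = refl
≤ᵇ-ord (suc zero)    zero          = refl
≤ᵇ-ord (suc (suc _)) zero          = refl

succᵇ-ord : ∀ m n → (suc m ≡ᵇ n) ≡ isAdjR (ord m n)
succᵇ-ord (suc m)       (suc n)       = succᵇ-ord m n
succᵇ-ord zero          zero          = refl
succᵇ-ord zero          (suc zero)    = refl
succᵇ-ord zero          (suc (suc _)) = refl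
succᵇ-ord (suc zero)    zero          = refl
succᵇ-ord (suc (suc _)) zero          = refl

≡ᵇ-ord : ∀ m n → (m ≡ᵇ n) ≡ isSame (ord m n)
≡ᵇ-ord (suc m)       (suc n)       = ≡ᵇ-ord m n
≡ᵇ-ord zero          zero          = refl
≡ᵇ-ord zero          (suc zero)    = refl
≡ᵇ-ord zero          (suc (suc _)) = refl
≡ᵇ-ord (suc zero)    zero          = refl
≡ᵇ-ord (suc (suc _)) zero          = refl

orient : Var → Var → OrdType → OrdType
orient vx vx o = self
orient vy vy o = self
orient vx vy o = o
orient vy vx o = mirror o

ord-orient : ∀ {N} (a b : Fin N) u v →
  ord (toℕ (pos a b u)) (toℕ (pos a b v)) ≡ orient u v (ord (toℕ a) (toℕ b))
ord-orient a b vx vx = ord-refl (toℕ a)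
ord-orient a b vx vy = refl
ord-orient a b vy vx = ord-mirror (toℕ a) (toℕ b)
ord-orient a b vy vy = ord-refl (toℕ b)

evalOT : ∀ {s} → QF s → Subset s → Subset s → OrdType → Bool
evalOT (atom P vx) u v o = lookup u P
evalOT (atom P vy) u v o = lookup v P
evalOT (leq p q)   u v o = isLeq (orient p q o)
evalOT (succ p q)  u v o = isAdjR (orient p q o)
evalOT (eq p q)    u v o = isSame (orient p q o)
evalOT tt          u v o = true
evalOT (¬ᶠ φ)      u v o = not (evalOT φ u v o)
evalOT (φ ∧ᶠ ψ)    u v o = evalOT φ u v o ∧ evalOT ψ u v o
evalOT (φ ∨ᶠ ψ)    u v o = evalOT φ u v o ∨ evalOT ψ u v o

eval-local : ∀ {s N} (ψ : QF s) (w : Word s N) a b →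
  eval ψ w a b ≡ evalOT ψ (w a) (w b) (ord (toℕ a) (toℕ b))
eval-local (atom P vx) w a b = refl
eval-local (atom P vy) w a b = refl
eval-local (leq p q)   w a b =
  trans (≤ᵇ-ord (toℕ (pos a b p)) (toℕ (pos a b q))) (cong isLeq (ord-orient a b p q))
eval-local (succ p q)  w a b =
  trans (succᵇ-ord (toℕ (pos a b p)) (toℕ (pos a b q))) (cong isAdjR (ord-orient a b p q))
eval-local (eq p q)    w a b =
  trans (≡ᵇ-ord (toℕ (pos a b p)) (toℕ (pos a b q))) (cong isSame (ord-orient a b p q))
eval-local tt          w a b = refl
eval-local (¬ᶠ φ)      w a b = cong not (eval-local φ w a b)
eval-local (φ ∧ᶠ ψ)    w a b = cong₂ _∧_ (eval-local φ w a b) (eval-local ψ w a b)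
eval-local (φ ∨ᶠ ψ)    w a b = cong₂ _∨_ (eval-local φ w a b) (eval-local ψ w a b)

record Agree {s} (S u v : Subset s) : Set where
  constructor agreeing
  field at : ∀ {P} → P ∈ˢ S → lookup u P ≡ lookup v P
open Agree

agree-⊆ : ∀ {s} {S S' u v : Subset s} → S ⊆ S' → Agree S' u v → Agree S u v
agree-⊆ S⊆S' agree = agreeing (λ P∈S → at agree (S⊆S' P∈S))

evalOT-agree : ∀ {s} (ψ : QF s) o {u u' v v' : Subset s} →
  Agree (symQF ψ) u u' → Agree (symQF ψ) v v' → evalOT ψ u v o ≡ evalOT ψ u' v' o
evalOT-agree (atom P vx) o hu hv = at hu (x∈⁅x⁆ P)
evalOT-agree (atom P vy) o hu hv = at hv (x∈⁅x⁆ P)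
evalOT-agree (leq p q)   o hu hv = refl
evalOT-agree (succ p q)  o hu hv = refl
evalOT-agree (eq p q)    o hu hv = refl
evalOT-agree tt          o hu hv = refl
evalOT-agree (¬ᶠ φ)      o hu hv = cong not (evalOT-agree φ o hu hv)
evalOT-agree (φ ∧ᶠ ψ)    o hu hv = cong₂ _∧_
  (evalOT-agree φ o (agree-⊆ (p⊆p∪q (symQF ψ)) hu) (agree-⊆ (p⊆p∪q (symQF ψ)) hv))
  (evalOT-agree ψ o (agree-⊆ (q⊆p∪q (symQF φ) _) hu) (agree-⊆ (q⊆p∪q (symQF φ) _) hv))
evalOT-agree (φ ∨ᶠ ψ)    o hu hv = cong₂ _∨_
  (evalOT-agree φ o (agree-⊆ (p⊆p∪q (symQF ψ)) hu) (agree-⊆ (p⊆p∪q (symQF ψ)) hv))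
  (evalOT-agree ψ o (agree-⊆ (q⊆p∪q (symQF φ) _) hu) (agree-⊆ (q⊆p∪q (symQF φ) _) hv))

restrict : ∀ {s} (S u : Subset s) → Vec Bool ∣ S ∣
restrict []          []      = []
restrict (true ∷ S)  (b ∷ u) = b ∷ restrict S u
restrict (false ∷ S) (b ∷ u) = restrict S u

extend : ∀ {s} (S : Subset s) → Vec Bool ∣ S ∣ → Subset s
extend []          []      = []
extend (true ∷ S)  (b ∷ v) = b ∷ extend S v
extend (false ∷ S) v       = false ∷ extend S v

extend-restrict : ∀ {s} (S u : Subset s) → Agree S u (extend S (restrict S u))
extend-restrict S u = agreeing (go S u)
  where
  go : ∀ {s} (S u : Subset s) {P} → P ∈ˢ S → lookup u P ≡ lookup (extend S (restrict S u)) P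
  go (true ∷ S)  (b ∷ u) Vec.here        = refl
  go (true ∷ S)  (b ∷ u) (Vec.there P∈S) = go S u P∈S
  go (false ∷ S) (b ∷ u) (Vec.there P∈S) = go S u P∈S

module Types {s} (S : Subset s) where

  open Inverse 2↔Bool using (to; from; strictlyInverseˡ)

  type : Subset s → Fin (2 ^ ∣ S ∣)
  type u = funToFin (from ∘ lookup (restrict S u))

  letter : Fin (2 ^ ∣ S ∣) → Subset s
  letter t = extend S (tabulate (to ∘ finToFun {2} {∣ S ∣} t))

  letter-type : ∀ u → Agree S u (letter (type u))
  letter-type u = subst (λ v → Agree S u (extend S v)) (sym decode) (extend-restrict S u)
    where
    r : Vec Bool ∣ S ∣
    r = restrict S u
    decode : tabulate (to ∘ finToFun {2} {∣ S ∣} (funToFin (from ∘ lookup r))) ≡ r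
    decode = trans (tabulate-cong (λ i → trans (cong to (finToFun-funToFin (from ∘ lookup r) i))
                                               (strictlyInverseˡ (lookup r i))))
                   (tabulate∘lookup r)

sumTo : (ℕ → ℕ) → ℕ → ℕ
sumTo f zero    = 0
sumTo f (suc n) = f 0 + sumTo (f ∘ suc) n

sumTo-cong : ∀ {f g} n → (∀ k → k < n → f k ≡ g k) → sumTo f n ≡ sumTo g n
sumTo-cong zero    f≗g = refl
sumTo-cong (suc n) f≗g = cong₂ _+_ (f≗g 0 (s≤s z≤n)) (sumTo-cong n (λ k k<n → f≗g (suc k) (s≤s k<n)))

sumTo-split : ∀ f m n → sumTo f (m + n) ≡ sumTo f m + sumTo (λ k → f (m + k)) n
sumTo-split f zero    n = refl
sumTo-split f (suc m) n =
  trans (cong (f 0 +_) (sumTo-split (f ∘ suc) m n)) (sym (+-assoc (f 0) _ _))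

bit : Bool → ℕ
bit false = 0
bit true  = 1

card-tabulate : ∀ N (g : ℕ → Bool) → ∣ tabulate {n = N} (g ∘ toℕ) ∣ ≡ sumTo (bit ∘ g) N
card-tabulate zero    g = refl
card-tabulate (suc N) g with g 0
... | true  = cong suc (card-tabulate N (g ∘ suc))
... | false = card-tabulate N (g ∘ suc)

-- Removing the block [c , c + d) from a word of length N' + d leaves a
-- word of length N'; skip c d sends its positions to the original ones.
skip : ℕ → ℕ → ℕ → ℕ
skip zero    d n       = n + d
skip (suc c) d zero    = zero
skip (suc c) d (suc n) = suc (skip c d n)

skip-below : ∀ {c d n} → n < c → skip c d n ≡ n
skip-below {suc c} {d} {zero}  _         = refl
skip-below {suc c} {d} {suc n} (s≤s n<c) = cong suc (skip-below n<c)

skip-above : ∀ {c d n} → c ≤ n → skip c d n ≡ n + d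
skip-above {zero}           _         = refl
skip-above {suc c} {d} {suc n} (s≤s c≤n) = cong suc (skip-above c≤n)

skip-shift : ∀ c d n → n ≢ c → skip (suc c) d n ≡ skip c d n
skip-shift zero    d zero    n≢c = contradiction refl n≢c
skip-shift zero    d (suc n) n≢c = refl
skip-shift (suc c) d zero    n≢c = refl
skip-shift (suc c) d (suc n) n≢c = cong suc (skip-shift c d n (n≢c ∘ cong suc))

cut-shift : ∀ {A : Set} (tp : ℕ → A) c d → tp c ≡ tp (c + d) →
  ∀ n → tp (skip (suc c) d n) ≡ tp (skip c d n)
cut-shift tp c d tpc≡ n with n ≟ c
... | yes refl = trans (cong tp (skip-below (n<1+n c))) (trans tpc≡ (cong tp (sym (skip-above {c} {d} ≤-refl))))
... | no  n≢c  = cong tp (skip-shift c d n n≢c)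

skip-< : ∀ {c d n N'} → c ≤ N' → n < N' → skip c d n < N' + d
skip-< {c} {d} {n} {N'} c≤N' n<N' with n <? c
... | yes n<c = subst (_< N' + d) (sym (skip-below n<c)) (≤-trans n<N' (m≤m+n N' d))
... | no  n≮c = subst (_< N' + d) (sym (skip-above (≮⇒≥ n≮c))) (+-monoˡ-< d n<N')

skip-<⁻ : ∀ {c d n N'} → c ≤ N' → skip c d n < N' + d → n < N'
skip-<⁻ {c} {d} {n} {N'} c≤N' sn< with n <? c
... | yes n<c = <-≤-trans n<c c≤N'
... | no  n≮c = +-cancelʳ-< d n N' (subst (_< N' + d) (skip-above (≮⇒≥ n≮c)) sn<)

skip-cover : ∀ c d b → (∃ λ n → skip c d n ≡ b) ⊎ (c ≤ b × b < c + d)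
skip-cover zero    d b with b <? d
... | yes b<d = inj₂ (z≤n , b<d)
... | no  b≮d = inj₁ (b ∸ d , m∸n+n≡m (≮⇒≥ b≮d))
skip-cover (suc c) d zero    = inj₁ (zero , refl)
skip-cover (suc c) d (suc b) =
  map⊎ (λ { (n , skip≡) → suc n , cong suc skip≡ }) (λ { (c≤b , b<c+d) → s≤s c≤b , s≤s b<c+d })
      (skip-cover c d b)

unskip-above : ∀ {c d n N'} → c + d ≤ n → n < N' + d → ∃ λ b → c ≤ b × b < N' × b + d ≡ n
unskip-above {c} {d} {n} {N'} c+d≤n n<N'+d =
  n ∸ d , m+n≤o⇒m≤o∸n c c+d≤n
        , subst (n ∸ d <_) (m+n∸n≡m N' d) (∸-monoˡ-< n<N'+d d≤n) , m∸n+n≡m d≤n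
  where
  d≤n : d ≤ n
  d≤n = ≤-trans (m≤n+m d c) c+d≤n

sumTo-skip : ∀ h c d N' → c ≤ N' →
  sumTo h (N' + d) ≡ sumTo (h ∘ skip c d) N' + sumTo (λ k → h (c + k)) d
sumTo-skip h zero d N' _ = begin
  sumTo h (N' + d)                                 ≡⟨ cong (sumTo h) (+-comm N' d) ⟩
  sumTo h (d + N')                                 ≡⟨ sumTo-split h d N' ⟩
  sumTo h d + sumTo (λ k → h (d + k)) N'           ≡⟨ +-comm (sumTo h d) _ ⟩
  sumTo (λ k → h (d + k)) N' + sumTo h d           ≡⟨ cong (_+ sumTo h d) (sumTo-cong N' (λ k _ →
                                                                                      cong h (+-comm d k))) ⟩
  sumTo (λ n → h (n + d)) N' + sumTo h d           ∎
  where open ≡-Reasoning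
sumTo-skip h (suc c) d (suc N') (s≤s c≤N') =
  trans (cong (h 0 +_) (sumTo-skip (h ∘ suc) c d N' c≤N')) (sym (+-assoc (h 0) _ _))

-- A position a is far from the cut at c if it is not adjacent to it in
-- the shortened word; the block then lies entirely to its right or left.
data Far (c a : ℕ) : Set where
  before : suc (suc a) ≤ c → Far c a
  after  : c < a → Far c a

side : ∀ {c a} → Far c a → OrdType
side (before _) = farR
side (after _)  = farL

ord-skip : ∀ {c a} d → Far c a → ∀ b → ord (skip c d a) (skip c d b) ≡ ord a b
ord-skip {c} {a} d (before a+2≤c) b with b <? c
... | yes b<c = cong₂ ord (skip-below (<-trans (n<1+n a) a+2≤c)) (skip-below b<c)
... | no  b≮c = trans (cong₂ ord (skip-below (<-trans (n<1+n a) a+2≤c)) (skip-above c≤b))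
                      (trans (ord-farR (≤-trans a+2≤b (m≤m+n b d))) (sym (ord-farR a+2≤b)))
  where
  c≤b : c ≤ b
  c≤b = ≮⇒≥ b≮c
  a+2≤b : suc (suc a) ≤ b
  a+2≤b = ≤-trans a+2≤c c≤b
ord-skip {c} {a} d (after c<a) b with b <? c
... | yes b<c = trans (cong₂ ord (skip-above (<⇒≤ c<a)) (skip-below b<c))
                      (trans (ord-farL (≤-trans b+2≤a (m≤m+n a d))) (sym (ord-farL b+2≤a)))
  where
  b+2≤a : suc (suc b) ≤ a
  b+2≤a = ≤-trans (s≤s b<c) c<a
... | no  b≮c = trans (cong₂ ord (skip-above (<⇒≤ c<a)) (skip-above (≮⇒≥ b≮c))) (ord-shiftʳ d a b)

ord-block : ∀ {c a b} d (f : Far c a) → c ≤ b → b < c + d → ord (skip c d a) b ≡ side f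
ord-block {c} {a} {b} d (before a+2≤c) c≤b _ =
  trans (cong (λ x → ord x b) (skip-below (<-trans (n<1+n a) a+2≤c))) (ord-farR (≤-trans a+2≤c c≤b))
ord-block {c} {a} {b} d (after c<a) _ b<c+d =
  trans (cong (λ x → ord x b) (skip-above (<⇒≤ c<a))) (ord-farL (≤-trans (s≤s b<c+d) (+-monoˡ-≤ d c<a)))

Interp : Set → Set
Interp A = A → A → OrdType → Bool

interp-cong : ∀ {A} (ev : Interp A) {t t' u u' o o'} →
  t ≡ t' → u ≡ u' → o ≡ o' → ev t u o ≡ ev t' u' o'
interp-cong ev refl refl refl = refl

module _ {A : Set} where

  holds : Interp A → (ℕ → A) → ℕ → ℕ → Bool
  holds ev tp a b = ev (tp a) (tp b) (ord a b)

  witnesses : Interp A → (ℕ → A) → ℕ → ℕ → ℕ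
  witnesses ev tp N a = sumTo (λ b → bit (holds ev tp a b)) N

  blockCount : Interp A → (ℕ → A) → ℕ → ℕ → A → OrdType → ℕ
  blockCount ev tp c d t o = sumTo (λ k → bit (ev t (tp (c + k)) o)) d

module SingleCut {A : Set} (tp tp' : ℕ → A) {c d N' : ℕ} (c≤N' : c ≤ N')
                 (tp'-skip : ∀ n → tp' n ≡ tp (skip c d n)) where

  holds-cut : ∀ ev {a} → Far c a → ∀ b →
    holds ev tp' a b ≡ holds ev tp (skip c d a) (skip c d b)
  holds-cut ev {a} f b = interp-cong ev (tp'-skip a) (tp'-skip b) (sym (ord-skip d f b))

  count-cut : ∀ ev {a} (f : Far c a) →
    witnesses ev tp (N' + d) (skip c d a) ≡ witnesses ev tp' N' a + blockCount ev tp c d (tp' a) (side f)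
  count-cut ev {a} f =
    trans (sumTo-skip _ c d N' c≤N')
          (cong₂ _+_ (sumTo-cong N' (λ n _ → cong bit (sym (holds-cut ev f n))))
                     (sumTo-cong d (λ k k<d → cong bit (interp-cong ev (sym (tp'-skip a)) refl
                                                   (ord-block d f (m≤m+n c k) (+-monoʳ-< c k<d))))))

  exists-cut : ∀ ev {a} (f : Far c a) →
    (∀ b → c ≤ b → b < c + d → ∃ λ b' → b' < N' × tp' b' ≡ tp b × ord a b' ≡ side f) →
    (∃ λ b → b < N' + d × T (holds ev tp (skip c d a) b)) →
    ∃ λ b' → b' < N' × T (holds ev tp' a b')
  exists-cut ev {a} f reappears (b , b<N , hb) with skip-cover c d b
  ... | inj₁ (n , refl) = n , skip-<⁻ c≤N' b<N , subst T (sym (holds-cut ev f n)) hb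
  ... | inj₂ (c≤b , b<c+d) with reappears b c≤b b<c+d
  ...   | b' , b'<N' , same-letter , same-side =
          b' , b'<N' , subst T (interp-cong ev (sym (tp'-skip a)) (sym same-letter)
                                  (trans (ord-block d f c≤b b<c+d) (sym same-side))) hb

_mod[_] : ∀ {s} → ℕ → ModConj s → ℕ
n mod[ mc ] = _%_ n (ModConj.l mc) {{>-nonZero (ModConj.l≥1 mc)}}

Accepts : ∀ {s} → ModConj s → ℕ → Set
Accepts mc n with ModConj.cmp mc
... | le = n mod[ mc ] ≤ ModConj.k mc
... | ge = ModConj.k mc ≤ n mod[ mc ]

accepts-resp : ∀ {s} (mc : ModConj s) {m n} → m mod[ mc ] ≡ n mod[ mc ] → Accepts mc m → Accepts mc n
accepts-resp mc r≡r' acc with ModConj.cmp mc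
... | le = subst (_≤ ModConj.k mc) r≡r' acc
... | ge = subst (ModConj.k mc ≤_) r≡r' acc

mod-remove : ∀ {s} (mc : ModConj s) m {n} → ModConj.l mc ∣ n → (m + n) mod[ mc ] ≡ m mod[ mc ]
mod-remove mc m l∣n = %-remove-+ʳ m {{>-nonZero (ModConj.l≥1 mc)}} l∣n

residue-cancel : ∀ x y l .{{_ : NonZero l}} → x % l ≡ (x + y) % l → l ∣ y
residue-cancel x y l same = ∣m+n∣m⇒∣n (subst (l ∣_) quotients (n∣m*n ((x + y) / l))) (n∣m*n (x / l))
  where
  open ≡-Reasoning
  quotients : ((x + y) / l) * l ≡ (x / l) * l + y
  quotients = +-cancelˡ-≡ (x % l) _ _ (begin
    x % l + ((x + y) / l) * l        ≡⟨ cong (_+ ((x + y) / l) * l) same ⟩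
    (x + y) % l + ((x + y) / l) * l  ≡⟨ sym (m≡m%n+[m/n]*n (x + y) l) ⟩
    x + y                            ≡⟨ cong (_+ y) (m≡m%n+[m/n]*n x l) ⟩
    x % l + (x / l) * l + y          ≡⟨ +-assoc (x % l) _ y ⟩
    x % l + ((x / l) * l + y)        ∎)

module Semantics {s} {A : Set} (⟦_⟧ : QF s → Interp A) (φ : NF s) where
  open NF φ
  open ModConj using () renaming (ψ to body; l to modulus)

  record Sat (tp : ℕ → A) (N : ℕ) : Set where
    field
      univ    : ∀ {a b} → a < N → b < N → T (holds ⟦ χ ⟧ tp a b)
      exist   : ∀ {ψ} → ψ ∈ exs → ∀ {a} → a < N → ∃ λ b → b < N × T (holds ⟦ ψ ⟧ tp a b)
      modular : ∀ {mc} → mc ∈ mods → ∀ {a} → a < N → Accepts mc (witnesses ⟦ body mc ⟧ tp N a)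

  record Pumpable (tp : ℕ → A) (p d N' : ℕ) : Set where
    field
      same-at        : tp p ≡ tp (p + d)
      same-next      : tp (suc p) ≡ tp (suc p + d)
      reappear-left  : ∀ b → b < p + d → ∃ λ b' → b' < p × tp b' ≡ tp b
      reappear-right : ∀ b → suc (suc p) ≤ b → b < suc (suc p) + d →
                       ∃ λ b' → suc (suc p) ≤ b' × b' < N' × tp (b' + d) ≡ tp b
      divides-left   : ∀ {mc} → mc ∈ mods → ∀ t → modulus mc ∣ blockCount ⟦ body mc ⟧ tp p d t farL
      divides-right  : ∀ {mc} → mc ∈ mods → ∀ t →
                       modulus mc ∣ blockCount ⟦ body mc ⟧ tp (suc (suc p)) d t farR

  module Pump {tp : ℕ → A} {p d N' : ℕ} (p+2≤N' : suc (suc p) ≤ N') (P : Pumpable tp p d N') where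
    open Pumpable P

    shortened : ℕ → A
    shortened = tp ∘ skip (suc (suc p)) d

    shortened-at-p : ∀ n → shortened n ≡ tp (skip p d n)
    shortened-at-p n = trans (cut-shift tp (suc p) d same-next n) (cut-shift tp p d same-at n)

    -- For each position a of the shortened word, one of the two cuts is far
    -- from a and satisfies the hypotheses of SingleCut.
    record CutAround (a : ℕ) : Set where
      field
        c         : ℕ
        far       : Far c a
        c≤N'      : c ≤ N'
        tp'-skip  : ∀ n → shortened n ≡ tp (skip c d n)
        reappears : ∀ b → c ≤ b → b < c + d →
                    ∃ λ b' → b' < N' × shortened b' ≡ tp b × ord a b' ≡ side far
        divides   : ∀ {mc} → mc ∈ mods → ∀ t → modulus mc ∣ blockCount ⟦ body mc ⟧ tp c d t (side far)

    -- Positions a ≤ p are far from the cut at p + 2, the others from the cut at p.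
    cut-around : ∀ a → CutAround a
    cut-around a with a ≤? p
    ... | yes a≤p = record
      { c = suc (suc p) ; far = before (s≤s (s≤s a≤p)) ; c≤N' = p+2≤N'
      ; tp'-skip = λ _ → refl ; reappears = right ; divides = divides-right }
      where
      right : ∀ b → suc (suc p) ≤ b → b < suc (suc p) + d →
              ∃ λ b' → b' < N' × shortened b' ≡ tp b × ord a b' ≡ farR
      right b p+2≤b b<p+2+d with reappear-right b p+2≤b b<p+2+d
      ... | b' , p+2≤b' , b'<N' , same-letter =
            b' , b'<N' , trans (cong tp (skip-above p+2≤b')) same-letter
               , ord-farR (≤-trans (s≤s (s≤s a≤p)) p+2≤b')
    ... | no  a≰p = record
      { c = p ; far = after p<a ; c≤N' = ≤-trans (n≤1+n p) (≤-trans (n≤1+n (suc p)) p+2≤N')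
      ; tp'-skip = shortened-at-p ; reappears = left ; divides = divides-left }
      where
      p<a : p < a
      p<a = ≰⇒> a≰p
      left : ∀ b → p ≤ b → b < p + d → ∃ λ b' → b' < N' × shortened b' ≡ tp b × ord a b' ≡ farL
      left b _ b<p+d with reappear-left b b<p+d
      ... | b' , b'<p , same-letter =
            b' , <-trans b'<p (<-trans (n<1+n p) p+2≤N')
               , trans (shortened-at-p b') (trans (cong tp (skip-below b'<p)) same-letter)
               , ord-farL (≤-trans (s≤s b'<p) p<a)

    -- Each conjunct of φ transfers through the cut around its first position.
    pump : Sat tp (N' + d) → Sat shortened N'
    pump M = record { univ = univ' ; exist = exist' ; modular = modular' }
      where
      open Sat M
      univ' : ∀ {a b} → a < N' → b < N' → T (holds ⟦ χ ⟧ shortened a b)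
      univ' {a} {b} a<N' b<N' =
        subst T (sym (holds-cut ⟦ χ ⟧ far b)) (univ (skip-< c≤N' a<N') (skip-< c≤N' b<N'))
        where open CutAround (cut-around a)
              open SingleCut tp shortened c≤N' tp'-skip
      exist' : ∀ {ψ} → ψ ∈ exs → ∀ {a} → a < N' → ∃ λ b → b < N' × T (holds ⟦ ψ ⟧ shortened a b)
      exist' {ψ} ψ∈ {a} a<N' = exists-cut ⟦ ψ ⟧ far reappears (exist ψ∈ (skip-< c≤N' a<N'))
        where open CutAround (cut-around a)
              open SingleCut tp shortened c≤N' tp'-skip
      modular' : ∀ {mc} → mc ∈ mods → ∀ {a} → a < N' → Accepts mc (witnesses ⟦ body mc ⟧ shortened N' a)
      modular' {mc} mc∈ {a} a<N' = accepts-resp mc residue (modular mc∈ (skip-< c≤N' a<N'))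
        where
        open CutAround (cut-around a)
        open SingleCut tp shortened c≤N' tp'-skip
        residue : witnesses ⟦ body mc ⟧ tp (N' + d) (skip c d a) mod[ mc ]
                ≡ witnesses ⟦ body mc ⟧ shortened N' a mod[ mc ]
        residue = trans (cong _mod[ mc ] (count-cut ⟦ body mc ⟧ far))
                        (mod-remove mc _ (divides mc∈ (shortened a)))

flag : ∀ {P : Set} → Dec P → Fin 2
flag (yes _) = Fin.suc Fin.zero
flag (no _)  = Fin.zero

flag-transfer : ∀ {P Q : Set} (P? : Dec P) (Q? : Dec Q) → flag P? ≡ flag Q? → P → Q
flag-transfer P?      (yes q) _  _ = q
flag-transfer (no ¬p) (no _)  _  p = contradiction p ¬p
flag-transfer (yes _) (no _)  ()

residueDigit : ∀ {s} (mc : ModConj s) → ℕ → Fin (ModConj.l mc)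
residueDigit mc n = fromℕ< (m%n<n n (ModConj.l mc) {{>-nonZero (ModConj.l≥1 mc)}})

residueDigit-inj : ∀ {s} (mc : ModConj s) {m n} →
  residueDigit mc m ≡ residueDigit mc n → m mod[ mc ] ≡ n mod[ mc ]
residueDigit-inj mc same = trans (sym (toℕ-fromℕ< _)) (trans (cong toℕ same) (toℕ-fromℕ< _))

residueSpace : ∀ {s} → List (ModConj s) → ℕ
residueSpace []         = 1
residueSpace (mc ∷ mcs) = ModConj.l mc * (ModConj.l mc * residueSpace mcs)

digitSpace : ∀ {s} → NF s → ℕ
digitSpace φ = 2 * (2 * (2 * (2 * residueSpace (NF.mods φ))))

module Profiles {s} {τ : ℕ} (⟦_⟧ : QF s → Interp (Fin τ)) (φ : NF s) (tp : ℕ → Fin τ) (N : ℕ) where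
  open NF φ
  open ModConj using () renaming (ψ to body; l to modulus)
  open Semantics ⟦_⟧ φ

  prefixCount : QF s → Fin τ → OrdType → ℕ → ℕ
  prefixCount ψ t o m = sumTo (λ n → bit (⟦ ψ ⟧ t (tp n) o)) m

  residues : (mcs : List (ModConj s)) → Fin τ → ℕ → Fin (residueSpace mcs)
  residues []         t p = Fin.zero
  residues (mc ∷ mcs) t p =
    combine (residueDigit mc (prefixCount (body mc) t farR (suc (suc p))))
            (combine (residueDigit mc (prefixCount (body mc) t farL p)) (residues mcs t p))

  occurs-before : ∀ t p → Dec (∃ λ n → n < p × tp n ≡ t)
  occurs-before t p = anyUpTo? (λ n → tp n ≟ᶠ t) p

  occurs-after : ∀ t p → Dec (∃ λ n → n < N × (suc (suc p) ≤ n × tp n ≡ t))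
  occurs-after t p = anyUpTo? (λ n → (suc (suc p) ≤? n) ×-dec (tp n ≟ᶠ t)) N

  digit : Fin τ → ℕ → Fin (digitSpace φ)
  digit t p = combine (flag (tp p ≟ᶠ t)) (combine (flag (tp (suc p) ≟ᶠ t))
              (combine (flag (occurs-before t p)) (combine (flag (occurs-after t p))
              (residues mods t p))))

  profile : ℕ → Fin (digitSpace φ ^ τ)
  profile p = funToFin (λ t → digit t p)

  profile-inj : ∀ {p q} → profile p ≡ profile q → ∀ t → digit t p ≡ digit t q
  profile-inj {p} {q} same t =
    trans (sym (finToFun-funToFin (λ t → digit t p) t))
          (trans (cong (λ x → finToFun {digitSpace φ} {τ} x t) same) (finToFun-funToFin (λ t → digit t q) t))

  record DigitsAgree (t : Fin τ) (p q : ℕ) : Set where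
    field
      at-eq       : flag (tp p ≟ᶠ t) ≡ flag (tp q ≟ᶠ t)
      next-eq     : flag (tp (suc p) ≟ᶠ t) ≡ flag (tp (suc q) ≟ᶠ t)
      before-eq   : flag (occurs-before t p) ≡ flag (occurs-before t q)
      after-eq    : flag (occurs-after t p) ≡ flag (occurs-after t q)
      residues-eq : residues mods t p ≡ residues mods t q

  digit-inj : ∀ {t p q} → digit t p ≡ digit t q → DigitsAgree t p q
  digit-inj e =
    let (e₁ , e') = combine-injective _ _ _ _ e
        (e₂ , e'') = combine-injective _ _ _ _ e'
        (e₃ , e''') = combine-injective _ _ _ _ e''
        (e₄ , e₅) = combine-injective _ _ _ _ e'''
    in record { at-eq = e₁ ; next-eq = e₂ ; before-eq = e₃ ; after-eq = e₄ ; residues-eq = e₅ }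

  residues-inj : ∀ mcs {t p q mc} → residues mcs t p ≡ residues mcs t q → mc ∈ mcs →
    (prefixCount (body mc) t farR (suc (suc p)) mod[ mc ] ≡ prefixCount (body mc) t farR (suc (suc q)) mod[ mc ])
    × (prefixCount (body mc) t farL p mod[ mc ] ≡ prefixCount (body mc) t farL q mod[ mc ])
  residues-inj (mc ∷ mcs) e (here refl) =
    let (r , e') = combine-injective {m = modulus mc} _ _ _ _ e
        (l , _)  = combine-injective {m = modulus mc} _ _ _ _ e'
    in residueDigit-inj mc r , residueDigit-inj mc l
  residues-inj (mc ∷ mcs) {t} {p} {q} e (there mc∈) =
    residues-inj mcs {t} {p} {q} (proj₂ (combine-injective {m = modulus mc} _ _ _ _
                                   (proj₂ (combine-injective {m = modulus mc} _ _ _ _ e)))) mc∈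

  block-divisible : ∀ mc t o m d →
    prefixCount (body mc) t o m mod[ mc ] ≡ prefixCount (body mc) t o (m + d) mod[ mc ] →
    modulus mc ∣ blockCount ⟦ body mc ⟧ tp m d t o
  block-divisible mc t o m d same-residue = residue-cancel _ _ _ {{>-nonZero (ModConj.l≥1 mc)}}
    (trans same-residue (cong _mod[ mc ] (sumTo-split (λ n → bit (⟦ body mc ⟧ t (tp n) o)) m d)))

  pumpable : ∀ {p d N'} → N ≡ N' + d → suc (suc p) ≤ N' → profile p ≡ profile (p + d) → Pumpable tp p d N'
  pumpable {p} {d} {N'} N≡ p+2≤N' same-profile = record
    { same-at        = sym (flag-transfer (tp p ≟ᶠ tp p) (tp (p + d) ≟ᶠ tp p) (at-eq (agree (tp p))) refl)
    ; same-next      = sym (flag-transfer (tp (suc p) ≟ᶠ tp (suc p)) (tp (suc p + d) ≟ᶠ tp (suc p))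
                                          (next-eq (agree (tp (suc p)))) refl)
    ; reappear-left  = λ b b<p+d → flag-transfer (occurs-before (tp b) (p + d)) (occurs-before (tp b) p)
                                                 (sym (before-eq (agree (tp b)))) (b , b<p+d , refl)
    ; reappear-right = right
    ; divides-left   = λ {mc} mc∈ t → block-divisible mc t farL p d (proj₂ (same-residues mc∈ t))
    ; divides-right  = λ {mc} mc∈ t → block-divisible mc t farR (suc (suc p)) d (proj₁ (same-residues mc∈ t))
    }
    where
    open DigitsAgree
    agree : ∀ t → DigitsAgree t p (p + d)
    agree t = digit-inj (profile-inj same-profile t)
    same-residues : ∀ {mc} → mc ∈ mods → ∀ t →
      (prefixCount (body mc) t farR (suc (suc p)) mod[ mc ] ≡ prefixCount (body mc) t farR (suc (suc (p + d))) mod[ mc ])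
      × (prefixCount (body mc) t farL p mod[ mc ] ≡ prefixCount (body mc) t farL (p + d) mod[ mc ])
    same-residues mc∈ t = residues-inj mods (residues-eq (agree t)) mc∈
    right : ∀ b → suc (suc p) ≤ b → b < suc (suc p) + d →
            ∃ λ b' → suc (suc p) ≤ b' × b' < N' × tp (b' + d) ≡ tp b
    right b p+2≤b b<p+2+d with flag-transfer (occurs-after (tp b) p) (occurs-after (tp b) (p + d))
                                 (after-eq (agree (tp b))) (b , b<N , p+2≤b , refl)
      where
      b<N : b < N
      b<N = subst (b <_) (sym N≡) (≤-trans b<p+2+d (+-monoˡ-≤ d p+2≤N'))
    ... | n , n<N , p+d+2≤n , same-letter with unskip-above p+d+2≤n (subst (n <_) N≡ n<N)
    ...   | b' , p+2≤b' , b'<N' , b'+d≡n = b' , p+2≤b' , b'<N' , trans (cong tp b'+d≡n) same-letter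

module Shrinking {s} {τ : ℕ} (⟦_⟧ : QF s → Interp (Fin τ)) (φ : NF s) where
  open Semantics ⟦_⟧ φ

  record Shorter (tp : ℕ → Fin τ) (N : ℕ) : Set where
    field
      length'  : ℕ
      reindex  : ℕ → ℕ
      shorter  : length' < N
      nonempty : 1 ≤ length'
      model    : Sat (tp ∘ reindex) length'

  -- Among the N₁ positions p < N₁ two share a profile; cut between them.
  shrink : ∀ {tp N₁} → digitSpace φ ^ τ < N₁ → Sat tp (suc N₁) → Shorter tp (suc N₁)
  shrink {tp} {N₁} many M = shorten (pigeonhole many (profile ∘ toℕ))
    where
    open Profiles ⟦_⟧ φ tp (suc N₁)
    shorten : (∃₂ λ i j → toℕ i < toℕ j × profile (toℕ i) ≡ profile (toℕ j)) → Shorter tp (suc N₁)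
    shorten (i , j , i<j , same-profile) = record
      { length' = N' ; reindex = skip (suc (suc p)) d ; shorter = ∸-monoʳ-< (m<n⇒0<n∸m i<j) d≤N
      ; nonempty = ≤-trans (s≤s z≤n) p+2≤N'
      ; model = Pump.pump p+2≤N' (pumpable N≡ p+2≤N' same-profile') (subst (Sat tp) N≡ M) }
      where
      p d N' : ℕ
      p = toℕ i
      d = toℕ j ∸ p
      N' = suc N₁ ∸ d
      p+d≡j : p + d ≡ toℕ j
      p+d≡j = m+[n∸m]≡n (<⇒≤ i<j)
      d≤N : d ≤ suc N₁
      d≤N = ≤-trans (m∸n≤m (toℕ j) p) (≤-trans (<⇒≤ (toℕ<n j)) (n≤1+n N₁))
      N≡ : suc N₁ ≡ N' + d
      N≡ = sym (m∸n+n≡m d≤N)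
      p+2≤N' : suc (suc p) ≤ N'
      p+2≤N' = m+n≤o⇒m≤o∸n (suc (suc p))
                 (subst (λ x → suc (suc x) ≤ suc N₁) (sym p+d≡j) (s≤s (toℕ<n j)))
      same-profile' : profile p ≡ profile (p + d)
      same-profile' = subst (λ x → profile p ≡ profile x) (sym p+d≡j) same-profile

modHolds→accepts : ∀ {s N} (mc : ModConj s) (w : Word s N) a →
  modHolds mc w a → Accepts mc (count (ModConj.ψ mc) w a)
modHolds→accepts mc w a h with ModConj.cmp mc
... | le = h
... | ge = h

accepts→modHolds : ∀ {s N} (mc : ModConj s) (w : Word s N) a →
  Accepts mc (count (ModConj.ψ mc) w a) → modHolds mc w a
accepts→modHolds mc w a h with ModConj.cmp mc
... | le = h
... | ge = h

fromFin : ∀ {N} (P : ℕ → Set) → (∀ (q : Fin N) → P (toℕ q)) → ∀ {a} → a < N → P a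
fromFin P h a<N = subst P (toℕ-fromℕ< a<N) (h (fromℕ< a<N))

⊆-⋃ : ∀ {s} {A : Set} (f : A → Subset s) {x xs} → x ∈ xs → f x ⊆ foldr _∪_ ⊥ (map f xs)
⊆-⋃ f {xs = y ∷ ys} (here refl) = p⊆p∪q _
⊆-⋃ f {xs = y ∷ ys} (there x∈) = ⊆-trans (⊆-⋃ f x∈) (q⊆p∪q (f y) _)

toSeq : ∀ {s N} → Word s N → ℕ → Subset s
toSeq {N = N} w n with n <? N
... | yes n<N = w (fromℕ< n<N)
... | no  _   = ⊥

toSeq-toℕ : ∀ {s N} (w : Word s N) q → toSeq w (toℕ q) ≡ w q
toSeq-toℕ {N = N} w q with toℕ q <? N
... | yes q<N = cong w (fromℕ<-toℕ q q<N)
... | no  q≮N = contradiction (toℕ<n q) q≮N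

module Bridge {s} (φ : NF s) where
  open NF φ
  open ModConj using () renaming (ψ to body)
  open Types (sig φ)

  ⟦_⟧ : QF s → Interp (Fin (oneTypes φ))
  ⟦ ψ ⟧ t t' o = evalOT ψ (letter t) (letter t') o

  open Semantics ⟦_⟧ φ

  sig-χ : symQF χ ⊆ sig φ
  sig-χ = p⊆p∪q _

  sig-exs : ∀ {ψ} → ψ ∈ exs → symQF ψ ⊆ sig φ
  sig-exs ψ∈ = ⊆-trans (⊆-⋃ symQF ψ∈) (⊆-trans (p⊆p∪q _) (q⊆p∪q (symQF χ) _))

  sig-mods : ∀ {mc} → mc ∈ mods → symQF (body mc) ⊆ sig φ
  sig-mods mc∈ = ⊆-trans (⊆-⋃ (symQF ∘ body) mc∈) (⊆-trans (q⊆p∪q _ _) (q⊆p∪q (symQF χ) _))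

  module _ {N} (w : Word s N) (f : ℕ → Subset s) (f-ext : ∀ q → f (toℕ q) ≡ w q) where

    tp : ℕ → Fin (oneTypes φ)
    tp = type ∘ f

    eval-holds : ∀ ψ → symQF ψ ⊆ sig φ → ∀ a b → eval ψ w a b ≡ holds ⟦ ψ ⟧ tp (toℕ a) (toℕ b)
    eval-holds ψ ψ⊆ a b = begin
      eval ψ w a b                            ≡⟨ eval-local ψ w a b ⟩
      evalOT ψ (w a) (w b) o                  ≡⟨ evalOT-agree ψ o (on (w a)) (on (w b)) ⟩
      ⟦ ψ ⟧ (type (w a)) (type (w b)) o       ≡⟨ cong₂ (λ u v → ⟦ ψ ⟧ (type u) (type v) o) (sym (f-ext a)) (sym (f-ext b)) ⟩
      holds ⟦ ψ ⟧ tp (toℕ a) (toℕ b)          ∎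
      where
      open ≡-Reasoning
      o : OrdType
      o = ord (toℕ a) (toℕ b)
      on : ∀ u → Agree (symQF ψ) u (letter (type u))
      on u = agree-⊆ ψ⊆ (letter-type u)

    count-witnesses : ∀ ψ → symQF ψ ⊆ sig φ → ∀ a → count ψ w a ≡ witnesses ⟦ ψ ⟧ tp N (toℕ a)
    count-witnesses ψ ψ⊆ a =
      trans (cong ∣_∣ (tabulate-cong (eval-holds ψ ψ⊆ a)))
            (card-tabulate N (holds ⟦ ψ ⟧ tp (toℕ a)))

    sat : w ⊨ φ → Sat tp N
    sat (hU , hE , hM) = record { univ = univ ; exist = exist ; modular = modular }
      where
      univ : ∀ {a b} → a < N → b < N → T (holds ⟦ χ ⟧ tp a b)
      univ a<N = fromFin (λ a → ∀ {b} → b < N → T (holds ⟦ χ ⟧ tp a b))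
        (λ q → fromFin (λ b → T (holds ⟦ χ ⟧ tp (toℕ q) b))
                 (λ r → subst T (eval-holds χ sig-χ q r) (hU q r))) a<N
      exist : ∀ {ψ} → ψ ∈ exs → ∀ {a} → a < N → ∃ λ b → b < N × T (holds ⟦ ψ ⟧ tp a b)
      exist {ψ} ψ∈ = fromFin (λ a → ∃ λ b → b < N × T (holds ⟦ ψ ⟧ tp a b)) witness
        where
        witness : ∀ q → ∃ λ b → b < N × T (holds ⟦ ψ ⟧ tp (toℕ q) b)
        witness q with All.lookup hE ψ∈ q
        ... | r , hr = toℕ r , toℕ<n r , subst T (eval-holds ψ (sig-exs ψ∈) q r) hr
      modular : ∀ {mc} → mc ∈ mods → ∀ {a} → a < N → Accepts mc (witnesses ⟦ body mc ⟧ tp N a)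
      modular {mc} mc∈ = fromFin (λ a → Accepts mc (witnesses ⟦ body mc ⟧ tp N a))
        (λ q → subst (Accepts mc) (count-witnesses (body mc) (sig-mods mc∈) q)
                     (modHolds→accepts mc w q (All.lookup hM mc∈ q)))

    models : Sat tp N → w ⊨ φ
    models M = univ' , All.tabulate exist' , All.tabulate modular'
      where
      open Sat M
      univ' : ∀ a b → T (eval χ w a b)
      univ' a b = subst T (sym (eval-holds χ sig-χ a b)) (univ (toℕ<n a) (toℕ<n b))
      exist' : ∀ {ψ} → ψ ∈ exs → ∀ a → ∃ λ b → T (eval ψ w a b)
      exist' {ψ} ψ∈ a with exist ψ∈ (toℕ<n a)
      ... | b , b<N , hb =
        fromℕ< b<N , subst T (sym (eval-holds ψ (sig-exs ψ∈) a (fromℕ< b<N)))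
                             (subst (λ x → T (holds ⟦ ψ ⟧ tp (toℕ a) x)) (sym (toℕ-fromℕ< b<N)) hb)
      modular' : ∀ {mc} → mc ∈ mods → ∀ a → modHolds mc w a
      modular' {mc} mc∈ a = accepts→modHolds mc w a
        (subst (Accepts mc) (sym (count-witnesses (body mc) (sig-mods mc∈) a)) (modular mc∈ (toℕ<n a)))

moduli : ∀ {s} → List (ModConj s) → ℕ
moduli mcs = product (map ModConj.l mcs)

moduli≥1 : ∀ {s} (mcs : List (ModConj s)) → 1 ≤ moduli mcs
moduli≥1 []         = s≤s z≤n
moduli≥1 (mc ∷ mcs) = *-mono-≤ (ModConj.l≥1 mc) (moduli≥1 mcs)

residueSpace≡ : ∀ {s} (mcs : List (ModConj s)) → residueSpace mcs ≡ moduli mcs * moduli mcs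
residueSpace≡ []         = refl
residueSpace≡ (mc ∷ mcs) = trans (cong (λ r → l * (l * r)) (residueSpace≡ mcs)) (square l (moduli mcs))
  where
  l : ℕ
  l = ModConj.l mc
  square : ∀ x y → x * (x * (y * y)) ≡ (x * y) * (x * y)
  square = solve-∀

-- The number of profiles is below 𝔣(φ): with D = 16 (l₁ ⋯ lₘ)² digits,
-- D ^ |α| < (2 D) ^ |α| ≤ ((2 l₁ ⋯ lₘ) ^ 5) ^ |α| = 𝔣(φ).
profiles<bound : ∀ {s} (φ : NF s) → digitSpace φ ^ oneTypes φ < bound φ
profiles<bound φ = begin-strict
  D ^ Tn              <⟨ ^-monoˡ-< Tn {{m^n≢0 2 ∣ sig φ ∣}} (m<m*n D 2 {{D≢0}} (s≤s (s≤s z≤n))) ⟩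
  (D * 2) ^ Tn        ≤⟨ ^-monoˡ-≤ Tn D*2≤ ⟩
  ((2 * P) ^ 5) ^ Tn  ≡⟨ ^-*-assoc (2 * P) 5 Tn ⟩
  bound φ             ∎
  where
  open ≤-Reasoning
  D Tn P : ℕ
  D = digitSpace φ
  Tn = oneTypes φ
  P = moduli (NF.mods φ)
  P≥1 : 1 ≤ P
  P≥1 = moduli≥1 (NF.mods φ)
  D≡ : D ≡ 2 * (2 * (2 * (2 * (P * P))))
  D≡ = cong (λ r → 2 * (2 * (2 * (2 * r)))) (residueSpace≡ (NF.mods φ))
  D≢0 : NonZero D
  D≢0 = >-nonZero (subst (1 ≤_) (sym D≡)
          (≤-trans (s≤s z≤n) (*-monoʳ-≤ 2 (*-monoʳ-≤ 2 (*-monoʳ-≤ 2 (*-monoʳ-≤ 2 (*-mono-≤ P≥1 P≥1)))))))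
  fifth : ∀ x → (2 * x) * ((2 * x) * ((2 * x) * ((2 * x) * ((2 * x) * 1))))
              ≡ (2 * (2 * (2 * (2 * (x * x))))) * 2 * (x * (x * x))
  fifth = solve-∀
  D*2≤ : D * 2 ≤ (2 * P) ^ 5
  P³≢0 : NonZero (P * (P * P))
  P³≢0 = >-nonZero (*-mono-≤ P≥1 (*-mono-≤ P≥1 P≥1))
  D*2≤ = begin
    D * 2                                                  ≡⟨ cong (_* 2) D≡ ⟩
    (2 * (2 * (2 * (2 * (P * P))))) * 2                    ≤⟨ m≤m*n _ _ {{P³≢0}} ⟩
    (2 * (2 * (2 * (2 * (P * P))))) * 2 * (P * (P * P))    ≡⟨ sym (fifth P) ⟩
    (2 * P) ^ 5                                            ∎

shorter-model : ∀ {s} (φ : NF s) {N} (w : Word s N) → w ⊨ φ → bound φ < N →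
  Σ ℕ λ N' → N' < N × 1 ≤ N' × Σ (Word s N') (λ w' → w' ⊨ φ)
shorter-model {s} φ {suc N₁} w w⊨φ (s≤s f≤N₁) =
  length' , shorter , nonempty , w' , models w' (f ∘ reindex) (λ _ → refl) model
  where
  open Bridge φ
  f : ℕ → Subset s
  f = toSeq w
  many : digitSpace φ ^ oneTypes φ < N₁
  many = <-≤-trans (profiles<bound φ) f≤N₁
  open Shrinking.Shorter (Shrinking.shrink ⟦_⟧ φ many (sat w f (toSeq-toℕ w) w⊨φ))
  w' : Word s length'
  w' q = f (reindex (toℕ q))

SmallModel : ∀ {s} → NF s → Set
SmallModel {s} φ = Σ ℕ (λ N → 1 ≤ N × N ≤ bound φ × Σ (Word s N) (λ w → w ⊨ φ))

small-model : ∀ {s} (φ : NF s) N (w : Word s N) → w ⊨ φ → 1 ≤ N → SmallModel φ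
small-model {s} φ = <-rec P step
  where
  P : ℕ → Set
  P N = (w : Word s N) → w ⊨ φ → 1 ≤ N → SmallModel φ
  step : ∀ N → (∀ {M} → M < N → P M) → P N
  step N rec w w⊨φ N≥1 = decide (N ≤? bound φ)
    where
    decide : Dec (N ≤ bound φ) → SmallModel φ
    decide (yes N≤f) = N , N≥1 , N≤f , w , w⊨φ
    decide (no N≰f) =
      let (N' , N'<N , N'≥1 , w' , w'⊨φ) = shorter-model φ w w⊨φ (≰⇒> N≰f)
      in rec N'<N w' w'⊨φ N'≥1

lemma7 : (s : ℕ) (φ : NF s)
    → Σ ℕ (λ N → 1 ≤ N × Σ (Word s N) (λ w → w ⊨ φ))
    → Σ ℕ (λ N → 1 ≤ N × N ≤ bound φ × Σ (Word s N) (λ w → w ⊨ φ))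
lemma7 s φ (N , N≥1 , w , w⊨φ) = small-model φ N w w⊨φ N≥1
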